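{- Let $D$ be a web diagram with $m\ge 1$ edges and let $W=W(D)$ be its web world. Then all row sums of the web-colouring matrix $M^{(W)}(x)$ are equal, and for every $D_1\in W$, $$\sum_{D_2\in W} M^{(W)}_{D_1,D_2}(x)\;=\;\sum_{\ell=1}^{m} x^{\ell}\,\ell!\,S(m,\ell),$$ where $S(m,\ell)$ denotes the Stirling number of the second kind (this is the ordered Bell polynomial).
   Context: A web diagram on $n$ pegs with $L$ edges is a set $D=\{e_j=(x_j,y_j,a_j,b_j):1\le j\le L\}$ of $L$ distinct 4-tuples of positive integers (edge $e_j$ joins peg $x_j$ at height $a_j$ to peg $y_j$ at height $b_j$) such that (i) $1\le x_j<y_j\le n$ for all $j$, and (ii) for each peg $i$, if $p_i(D)$ is the number of $j$ with $x_j=i$ or $y_j=i$, then $\{b_j:y_j=i\}\cup\{a_j:x_j=i\}=\{1,\dots,p_i(D)\}$. For web diagrams $D,D'$ with pegs in $\{1,\dots,n\}$, the sum is $D\oplus D'=D\cup\{(x',y',a'+p_{x'}(D),b'+p_{y'}(D)):(x',y',a',b')\in D'\}$ ($D'$ placed on top of $D$). For $X\subseteq D$, $\mathrm{rel}(X)$ is the web diagram obtained from $X$ by relabelling, on each peg, the heights of the endpoints of edges of $X$ by $1,2,\dots,\ell_i$ preserving their relative order. The web world $W(D)$ is the set of all web diagrams obtained from $D$ by permuting, independently on each peg $i$, the heights $1,\dots,p_i(D)$ of the endpoints on that peg. An $\ell$-colouring of $D$ is a surjection $c:\{1,\dots,L\}\to\{1,\dots,\ell\}$; with $D_c(t)=\{e_j:c(j)=t\}$,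 the reconstruction of $D$ according to $c$ is $\mathcal{R}(D,c)=\mathrm{rel}(D_c(1))\oplus\cdots\oplus\mathrm{rel}(D_c(\ell))\in W(D)$. For $D_1,D_2\in W$, $f(D_1,D_2,\ell)$ is the number of $\ell$-colourings $c$ of $D_1$ with $\mathcal{R}(D_1,c)=D_2$. The web-colouring matrix $M^{(W)}(x)$ is indexed by $W\times W$ with entries $M^{(W)}_{D_1,D_2}(x)=\sum_{\ell\ge1}x^\ell f(D_1,D_2,\ell)$. -}

module Defs where

open import Data.Nat using (ℕ; zero; suc; _+_; _*_; _≤_; _<_; _≤?_; _≟_)
open import Data.Nat using (_!)
open import Data.Fin using (Fin; zero; suc)
import Data.Fin as Fin
open import Data.Fin.Properties using (any?) renaming (all? to allFin?)
open import Data.List using (List; []; _∷_; [_]; _++_; map; filter; length; concatMap; foldl; upTo; allFin; lookup)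
open import Data.Nat.ListAction using (sum)
open import Data.List.Relation.Unary.All using (All)
open import Data.List.Relation.Unary.All using (all?)
open import Data.List.Relation.Unary.Any using (Any)
open import Data.List.Relation.Unary.Unique.Propositional using (Unique)
open import Data.List.Relation.Unary.AllPairs using (AllPairs)
open import Data.Product using (Σ; ∃; _×_; _,_; proj₁; proj₂)
open import Data.Product.Properties using (≡-dec)
open import Data.Sum using (_⊎_)
open import Relation.Nullary using (Dec; ¬_; yes; no)
open import Relation.Nullary.Decidable using (_×-dec_; _⊎-dec_)
open import Relation.Binary.PropositionalEquality using (_≡_)
open import Relation.Binary.Definitions using (DecidableEquality)
open import Function.Bundles using (_⇔_)

-- An edge (x , y , a , b) joins peg x at height a to peg y at height b.
Edge : Set
Edge = ℕ × ℕ × ℕ × ℕ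

ex ey ea eb : Edge → ℕ
ex (x , _ , _ , _) = x
ey (_ , y , _ , _) = y
ea (_ , _ , a , _) = a
eb (_ , _ , _ , b) = b

_≟E_ : DecidableEquality Edge
_≟E_ = ≡-dec _≟_ (≡-dec _≟_ (≡-dec _≟_ _≟_))

-- A (candidate) diagram is a finite list of edges; the list order
-- provides the indexing e_1, …, e_L.
Diagram : Set
Diagram = List Edge

p : ℕ → Diagram → ℕ
p i D = length (filter (λ e → (ex e ≟ i) ⊎-dec (ey e ≟ i)) D)

heights : ℕ → Diagram → List ℕ
heights i D = concatMap (λ e → hx e ++ hy e) D
  where
  hx hy : Edge → List ℕ
  hx e with ex e ≟ i
  ... | yes _ = [ ea e ]
  ... | no  _ = []
  hy e with ey e ≟ i
  ... | yes _ = [ eb e ]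
  ... | no  _ = []

_∈ℕ_ : ℕ → List ℕ → Set
h ∈ℕ hs = Any (h ≡_) hs

_∈E_ : Edge → Diagram → Set
e ∈E D = Any (e ≡_) D

IsWeb : ℕ → Diagram → Set
IsWeb n D =
  Unique D ×
  All (λ e → 1 ≤ ex e × ex e < ey e × ey e ≤ n × 1 ≤ ea e × 1 ≤ eb e) D ×
  (∀ i → ∀ h → (h ∈ℕ heights i D) ⇔ (1 ≤ h × h ≤ p i D))

_≈D_ : Diagram → Diagram → Set
A ≈D B = All (λ e → e ∈E B) A × All (λ e → e ∈E A) B

_≈D?_ : (A B : Diagram) → Dec (A ≈D B)
A ≈D? B = all? (λ e → Data.List.Relation.Unary.Any.any? (e ≟E_) B) A
      ×-dec all? (λ e → Data.List.Relation.Unary.Any.any? (e ≟E_) A) B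

-- D ⊕ D' : D' placed on top of D
_⊕_ : Diagram → Diagram → Diagram
D ⊕ D' = D ++ map (λ { (x' , y' , a' , b') → (x' , y' , a' + p x' D , b' + p y' D) }) D'

-- rank of height h among the heights on peg i of X (relative order, 1-based)
rank : ℕ → ℕ → Diagram → ℕ
rank i h X = length (filter (λ h' → h' ≤? h) (heights i X))

rel : Diagram → Diagram
rel X = map (λ { (x , y , a , b) → (x , y , rank x a X , rank y b X) }) X

colourClass : (D : Diagram) {ℓ : ℕ} → (Fin (length D) → Fin ℓ) → Fin ℓ → Diagram
colourClass D c t =
  map (lookup D) (filter (λ j → c j Data.Fin.≟ t) (allFin (length D)))

reconstruct : (D : Diagram) {ℓ : ℕ} → (Fin (length D) → Fin ℓ) → Diagram
reconstruct D {ℓ} c = foldl (λ acc t → acc ⊕ rel (colourClass D c t)) [] (allFin ℓ)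

allFuns : (L ℓ : ℕ) → List (Fin L → Fin ℓ)
allFuns zero    ℓ = (λ ()) ∷ []
allFuns (suc L) ℓ =
  concatMap (λ f → map (λ k → λ { zero → k ; (suc j) → f j }) (allFin ℓ)) (allFuns L ℓ)

IsSurj : {L ℓ : ℕ} → (Fin L → Fin ℓ) → Set
IsSurj {L} {ℓ} c = ∀ (t : Fin ℓ) → ∃ λ (j : Fin L) → c j ≡ t

isSurj? : {L ℓ : ℕ} (c : Fin L → Fin ℓ) → Dec (IsSurj c)
isSurj? c = allFin? (λ t → any? (λ j → c j Data.Fin.≟ t))

fcount : Diagram → Diagram → ℕ → ℕ
fcount D1 D2 ℓ =
  length (filter (λ c → isSurj? c ×-dec (reconstruct D1 c ≈D? D2))
                 (allFuns (length D1) ℓ))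

-- coefficient of x^ℓ in M^{(W)}_{D1,D2}(x) = Σ_{ℓ≥1} x^ℓ f(D1,D2,ℓ)
Mcoef : Diagram → Diagram → ℕ → ℕ
Mcoef D1 D2 zero    = 0
Mcoef D1 D2 (suc ℓ) = fcount D1 D2 (suc ℓ)

IsPermOf : ℕ → (ℕ → ℕ) → Set
IsPermOf k σ =
  (∀ h → 1 ≤ h → h ≤ k → 1 ≤ σ h × σ h ≤ k) ×
  (∀ h h' → 1 ≤ h → h ≤ k → 1 ≤ h' → h' ≤ k → σ h ≡ σ h' → h ≡ h')

-- D' ∈ W(D): D' (as a set, represented by a duplicate-free list) is
-- obtained from D by permuting, independently on each peg i, the heights 1..p_i(D)
InWorld : Diagram → Diagram → Set
InWorld D D' = Unique D' ×
  Σ (ℕ → ℕ → ℕ) λ σ →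
    (∀ i → IsPermOf (p i D) (σ i)) ×
    (D' ≈D map (λ { (x , y , a , b) → (x , y , σ x a , σ y b) }) D)

EnumeratesWorld : Diagram → List Diagram → Set
EnumeratesWorld D Ws =
  All (InWorld D) Ws ×
  (∀ D2 → InWorld D D2 → Any (λ D' → D2 ≈D D') Ws) ×
  AllPairs (λ A B → ¬ (A ≈D B)) Ws

rowSumCoef : List Diagram → Diagram → ℕ → ℕ
rowSumCoef Ws D1 ℓ = sum (map (λ D2 → Mcoef D1 D2 ℓ) Ws)

S₂ : ℕ → ℕ → ℕ
S₂ zero    zero    = 1
S₂ zero    (suc k) = 0
S₂ (suc m) zero    = 0
S₂ (suc m) (suc k) = suc k * S₂ m (suc k) + S₂ m k

orderedBellCoef : ℕ → ℕ → ℕ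
orderedBellCoef m zero = 0
orderedBellCoef m (suc ℓ) with suc ℓ ≤? m
... | yes _ = (suc ℓ) ! * S₂ m (suc ℓ)
... | no  _ = 0

module Submission where

-- The coefficient of x^ℓ in the row sum of D₁ is
--   Σ_{D₂ ∈ Ws} #{ surjective colourings c : Fin |D₁| → Fin ℓ with R(D₁,c) = D₂ }.
-- (1) Every reconstruction R(D₁,c) lies in W(D) (reconstruct-inWorld). As Ws lists
--     each member of W(D) exactly once, every colouring is counted for exactly one
--     D₂ (count-fibres, exactly-one), so the coefficient is the number of
--     surjections Fin |D₁| → Fin ℓ; and |D₁| = |D|.
-- (2) That number is ℓ! S(|D|,ℓ) (count-surjections), shown by counting maps with
--     a prescribed image by recursion on the value of the first point; it vanishes
--     for ℓ > |D|, which gives the ordered Bell coefficients.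
-- The proof of (1) follows the sum rel(D_c(1)) ⊕ ⋯ ⊕ rel(D_c(t)) with the invariant
-- Stacked: it rearranges the first t colour classes relabelled, on each peg, by a
-- map injective into 1 … p_i (stack-step). The classes together rearrange D₁, which
-- rearranges D relabelled by permutations, so R(D₁,c) is D relabelled by a
-- permutation of the heights of each peg.

open import Defs
open import Data.Bool using (Bool; true; false; if_then_else_)
import Data.Bool as Bool
open import Data.Nat using (ℕ; zero; suc; _+_; _*_; _≤_; _<_; _≤?_; _≟_; _!; z≤n; s≤s)
open import Data.Nat.Properties
  using ( +-identityʳ; *-zeroʳ; *-distribˡ-+; *-distribʳ-+; +-suc; +-comm; +-mono-≤; +-mono-≤-<; +-monoˡ-≤
        ; +-cancelʳ-≡; suc-injective; 0≢1+n; ≤-reflexive; ≤-refl; ≤-trans; ≤-pred; <⇒≤; <⇒≱; <⇒≢; <-cmp; ≰⇒>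
        ; m≤n⇒m≤1+n; m≤n+m; m≤m+n; +-commutativeSemigroup )
open import Algebra.Properties.CommutativeSemigroup +-commutativeSemigroup using () renaming (interchange to +-interchange)
open import Data.Nat.ListAction using (sum)
open import Data.Nat.ListAction.Properties using (sum-++)
open import Data.Fin using (Fin; zero; suc)
import Data.Fin as Fin
open import Data.Fin.Properties using (any?; all?)
open import Data.Vec.Functional using () renaming (_∷_ to _∷ᶠ_)
open import Data.List using (List; []; _∷_; [_]; _++_; map; filter; length; concatMap; foldl; allFin; lookup; upTo)
open import Data.List.Properties
  using ( map-++; map-∘; map-tabulate; map-cong-local; map-concatMap; concatMap-++; filter-++; length-++
        ; length-filter; length-map; length-upTo; ++-assoc; ++-identityʳ; tabulate-lookup )
open import Data.List.Relation.Unary.All as All using (All; []; _∷_)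
import Data.List.Relation.Unary.All.Properties as Allₚ
open import Data.List.Relation.Unary.Any as Any using (Any; here; there)
open import Data.List.Relation.Unary.AllPairs as AllPairs using (AllPairs; []; _∷_)
import Data.List.Relation.Unary.AllPairs.Properties as AllPairsₚ
open import Data.List.Relation.Unary.Unique.Propositional using (Unique)
import Data.List.Relation.Unary.Unique.Propositional.Properties as Unique
open import Data.List.Membership.Propositional using (_∈_; _∉_)
open import Data.List.Membership.Propositional.Properties
  using ( ∈-++⁺ˡ; ∈-++⁺ʳ; ∈-++⁻; ∈-map⁺; ∈-map⁻; ∈-∃++; ∈-filter⁺; ∈-filter⁻; ∈-concatMap⁺; ∈-concatMap⁻
        ; ∈-allFin; ∈-upTo⁻ )
open import Data.List.Membership.Propositional.Properties.WithK using (unique∧set⇒bag)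
open import Data.List.Membership.DecPropositional _≟_ using (_∈?_)
open import Data.List.Relation.Binary.BagAndSetEquality using (∼bag⇒↭)
open import Data.List.Relation.Binary.Permutation.Propositional using (_↭_; ↭-refl; ↭-sym; ↭-trans; ↭-reflexive; ↭⇒↭ₛ)
open import Data.List.Relation.Binary.Permutation.Propositional.Properties using (↭-length; ∈-resp-↭; filter-↭; shift; map⁺; ++⁺ʳ)
import Data.List.Relation.Binary.Permutation.Setoid.Properties as Permutationₛ
open import Data.Product using (∃; _×_; _,_; proj₁; proj₂)
open import Data.Sum using (_⊎_; inj₁; inj₂; [_,_]′)
open import Data.Empty using (⊥; ⊥-elim)
open import Function using (_∘_)
open import Function.Bundles using (mk⇔; Equivalence)
open import Relation.Nullary using (Dec; yes; no; ¬_; does; contradiction)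
open import Relation.Nullary.Decidable using (_×-dec_; _⊎-dec_; dec-true; dec-false; toSum)
open import Relation.Unary using (Decidable)
open import Relation.Binary.Definitions using (DecidableEquality; tri<; tri≈; tri>)
open import Relation.Binary.PropositionalEquality hiding ([_])
open ≡-Reasoning

bit : Bool → ℕ
bit true  = 1
bit false = 0

indicator : {P : Set} → Dec P → ℕ
indicator p = bit (does p)

does-⇔ : {P Q : Set} (p : Dec P) (q : Dec Q) → (P → Q) → (Q → P) → does p ≡ does q
does-⇔ (yes _) (yes _) _  _  = refl
does-⇔ (yes a) (no ¬b) to _  = ⊥-elim (¬b (to a))
does-⇔ (no ¬a) (yes b) _ from = ⊥-elim (¬a (from b))
does-⇔ (no _)  (no _)  _  _  = refl

indicator-⇔ : {P Q : Set} (p : Dec P) (q : Dec Q) → (P → Q) → (Q → P) → indicator p ≡ indicator q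
indicator-⇔ p q to from = cong bit (does-⇔ p q to from)

indicator-yes : {P : Set} (p : Dec P) → P → indicator p ≡ 1
indicator-yes p a = cong bit (dec-true p a)

indicator-no : {P : Set} (p : Dec P) → ¬ P → indicator p ≡ 0
indicator-no p ¬a = cong bit (dec-false p ¬a)

indicator-× : {P Q : Set} (p : Dec P) (q : Dec Q) → indicator (p ×-dec q) ≡ indicator p * indicator q
indicator-× (yes _) (yes _) = refl
indicator-× (yes _) (no _)  = refl
indicator-× (no _)  _       = refl

module _ {X : Set} where

  count : {P : X → Set} → Decidable P → List X → ℕ
  count P? xs = length (filter P? xs)

  count-∷ : {P : X → Set} (P? : Decidable P) (x : X) (xs : List X) →
            count P? (x ∷ xs) ≡ indicator (P? x) + count P? xs
  count-∷ P? x xs with P? x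
  ... | yes _ = refl
  ... | no _  = refl

  count≡sum : {P : X → Set} (P? : Decidable P) (xs : List X) →
              count P? xs ≡ sum (map (λ x → indicator (P? x)) xs)
  count≡sum P? []       = refl
  count≡sum P? (x ∷ xs) = trans (count-∷ P? x xs) (cong (indicator (P? x) +_) (count≡sum P? xs))

  sum-map-cong : {f g : X → ℕ} (xs : List X) → (∀ x → f x ≡ g x) → sum (map f xs) ≡ sum (map g xs)
  sum-map-cong []       _   = refl
  sum-map-cong (x ∷ xs) f≗g = cong₂ _+_ (f≗g x) (sum-map-cong xs f≗g)

  count-⇔ : {P Q : X → Set} (P? : Decidable P) (Q? : Decidable Q) →
            (∀ x → P x → Q x) → (∀ x → Q x → P x) → (xs : List X) → count P? xs ≡ count Q? xs
  count-⇔ P? Q? to from xs = begin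
    count P? xs                           ≡⟨ count≡sum P? xs ⟩
    sum (map (λ x → indicator (P? x)) xs) ≡⟨ sum-map-cong xs (λ x → indicator-⇔ (P? x) (Q? x) (to x) (from x)) ⟩
    sum (map (λ x → indicator (Q? x)) xs) ≡⟨ count≡sum Q? xs ⟨
    count Q? xs                           ∎

  sum-map-+ : (f g : X → ℕ) (xs : List X) → sum (map (λ x → f x + g x) xs) ≡ sum (map f xs) + sum (map g xs)
  sum-map-+ f g []       = refl
  sum-map-+ f g (x ∷ xs) = begin
    f x + g x + sum (map (λ x → f x + g x) xs)     ≡⟨ cong (f x + g x +_) (sum-map-+ f g xs) ⟩
    f x + g x + (sum (map f xs) + sum (map g xs))  ≡⟨ +-interchange (f x) (g x) _ _ ⟩
    f x + sum (map f xs) + (g x + sum (map g xs))  ∎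

  sum-map-zero : (f : X → ℕ) {xs : List X} → All (λ x → f x ≡ 0) xs → sum (map f xs) ≡ 0
  sum-map-zero f []         = refl
  sum-map-zero f (z ∷ zs)   = cong₂ _+_ z (sum-map-zero f zs)

  sum-map-*ˡ : (c : ℕ) (f : X → ℕ) (xs : List X) → sum (map (λ x → c * f x) xs) ≡ c * sum (map f xs)
  sum-map-*ˡ c f []       = sym (*-zeroʳ c)
  sum-map-*ˡ c f (x ∷ xs) = trans (cong (c * f x +_) (sum-map-*ˡ c f xs)) (sym (*-distribˡ-+ c (f x) _))

module _ {X Y : Set} where

  sum-map-concatMap : (F : Y → ℕ) (g : X → List Y) (xs : List X) →
                      sum (map F (concatMap g xs)) ≡ sum (map (λ x → sum (map F (g x))) xs)
  sum-map-concatMap F g []       = refl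
  sum-map-concatMap F g (x ∷ xs) = begin
    sum (map F (g x ++ concatMap g xs))                        ≡⟨ cong sum (map-++ F (g x) (concatMap g xs)) ⟩
    sum (map F (g x) ++ map F (concatMap g xs))                ≡⟨ sum-++ (map F (g x)) _ ⟩
    sum (map F (g x)) + sum (map F (concatMap g xs))           ≡⟨ cong (sum (map F (g x)) +_) (sum-map-concatMap F g xs) ⟩
    sum (map F (g x)) + sum (map (λ x → sum (map F (g x))) xs) ∎

  sum-map-swap : (G : X → Y → ℕ) (xs : List X) (ys : List Y) →
                 sum (map (λ x → sum (map (G x) ys)) xs) ≡ sum (map (λ y → sum (map (λ x → G x y) xs)) ys)
  sum-map-swap G []       ys = sym (sum-map-zero _ (All.universal (λ _ → refl) ys))
  sum-map-swap G (x ∷ xs) ys = begin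
    sum (map (G x) ys) + sum (map (λ x → sum (map (G x) ys)) xs)     ≡⟨ cong (sum (map (G x) ys) +_) (sum-map-swap G xs ys) ⟩
    sum (map (G x) ys) + sum (map (λ y → sum (map (λ x → G x y) xs)) ys) ≡⟨ sum-map-+ (G x) _ ys ⟨
    sum (map (λ y → G x y + sum (map (λ x → G x y) xs)) ys)          ∎

module _ {X Y : Set} where

  count-fibres : {S : X → Set} (S? : Decidable S) {Q : Y → X → Set} (Q? : ∀ w x → Dec (Q w x))
                 (xs : List X) (ws : List Y) →
                 (∀ x → S x → sum (map (λ w → indicator (Q? w x)) ws) ≡ 1) →
                 sum (map (λ w → count (λ x → S? x ×-dec Q? w x) xs) ws) ≡ count S? xs
  count-fibres {S} S? {Q} Q? xs ws unique-fibre = begin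
    sum (map (λ w → count (λ x → S? x ×-dec Q? w x) xs) ws)
      ≡⟨ sum-map-cong ws (λ w → count≡sum (λ x → S? x ×-dec Q? w x) xs) ⟩
    sum (map (λ w → sum (map (λ x → indicator (S? x ×-dec Q? w x)) xs)) ws)
      ≡⟨ sum-map-swap (λ w x → indicator (S? x ×-dec Q? w x)) ws xs ⟩
    sum (map (λ x → sum (map (λ w → indicator (S? x ×-dec Q? w x)) ws)) xs)
      ≡⟨ sum-map-cong xs fibre ⟩
    sum (map (λ x → indicator (S? x)) xs)
      ≡⟨ count≡sum S? xs ⟨
    count S? xs ∎
    where
    fibre : ∀ x → sum (map (λ w → indicator (S? x ×-dec Q? w x)) ws) ≡ indicator (S? x)
    fibre x = begin
      sum (map (λ w → indicator (S? x ×-dec Q? w x)) ws)       ≡⟨ sum-map-cong ws (λ w → indicator-× (S? x) (Q? w x)) ⟩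
      sum (map (λ w → indicator (S? x) * indicator (Q? w x)) ws) ≡⟨ sum-map-*ˡ (indicator (S? x)) _ ws ⟩
      indicator (S? x) * sum (map (λ w → indicator (Q? w x)) ws) ≡⟨ weight (S? x) ⟩
      indicator (S? x) ∎
      where
      weight : (s : Dec (S x)) → indicator s * sum (map (λ w → indicator (Q? w x)) ws) ≡ indicator s
      weight (yes s) = trans (+-identityʳ _) (unique-fibre x s)
      weight (no _)  = refl

module _ {Y : Set} {R : Y → Y → Set} (R? : ∀ a b → Dec (R a b))
         (R-sym : ∀ {a b} → R a b → R b a) (R-trans : ∀ {a b c} → R a b → R b c → R a c) where

  exactly-one : (r : Y) (ws : List Y) → Any (R r) ws → AllPairs (λ a b → ¬ R a b) ws →
                sum (map (λ w → indicator (R? r w)) ws) ≡ 1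
  exactly-one r (w ∷ ws) (here rw) (w≁ws ∷ _) =
    cong₂ _+_ (indicator-yes (R? r w) rw)
              (sum-map-zero _ (All.map (λ {w′} w≁w′ → indicator-no (R? r w′) (λ rw′ → w≁w′ (R-trans (R-sym rw) rw′))) w≁ws))
  exactly-one r (w ∷ ws) (there r∈ws) (w≁ws ∷ distinct) =
    cong₂ _+_ (indicator-no (R? r w) (λ rw → All.lookupWith (λ w≁v rv → w≁v (R-trans (R-sym rw) rv)) w≁ws r∈ws)) (exactly-one r ws r∈ws distinct)

Subset : ℕ → Set
Subset k = Fin k → Bool

size : ∀ {k} → Subset k → ℕ
size {zero}  T = 0
size {suc k} T = bit (T zero) + size (T ∘ suc)

remove : ∀ {k} → Subset k → Fin k → Subset k
remove T t₀ t = if does (t Fin.≟ t₀) then false else T t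

size-full : ∀ k → size {k} (λ _ → true) ≡ k
size-full zero    = refl
size-full (suc k) = cong suc (size-full k)

size-zero⇒empty : ∀ {k} (T : Subset k) → size T ≡ 0 → ∀ t → T t ≡ false
size-zero⇒empty {suc k} T eq t with T zero in T0
size-zero⇒empty {suc k} T eq zero    | false = T0
size-zero⇒empty {suc k} T eq (suc t) | false = size-zero⇒empty (T ∘ suc) eq t

empty⇒size-zero : ∀ {k} (T : Subset k) → (∀ t → T t ≡ false) → size T ≡ 0
empty⇒size-zero {zero}  T _     = refl
empty⇒size-zero {suc k} T empty rewrite empty zero = empty⇒size-zero (T ∘ suc) (empty ∘ suc)

size-remove : ∀ {k} (T : Subset k) t₀ → T t₀ ≡ true → suc (size (remove T t₀)) ≡ size T
size-remove {suc k} T zero     T₀ rewrite T₀ = refl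
size-remove {suc k} T (suc t₀) T₀ =
  trans (sym (+-suc (bit (T zero)) _)) (cong (bit (T zero) +_) (size-remove (T ∘ suc) t₀ T₀))

map-allFin-suc : ∀ {A : Set} {k} (h : Fin (suc k) → A) → map h (allFin (suc k)) ≡ h zero ∷ map (h ∘ suc) (allFin k)
map-allFin-suc h = cong (h zero ∷_) (trans (map-tabulate suc h) (sym (map-tabulate (λ t → t) (h ∘ suc))))

sum-over-subset : ∀ {k} (T : Subset k) (F : Fin k → ℕ) (C : ℕ) → (∀ t → T t ≡ true → F t ≡ C) →
                  sum (map (λ t → bit (T t) * F t) (allFin k)) ≡ size T * C
sum-over-subset {zero}  T F C _      = refl
sum-over-subset {suc k} T F C F≡C = begin
  sum (map (λ t → bit (T t) * F t) (allFin (suc k)))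
    ≡⟨ cong sum (map-allFin-suc (λ t → bit (T t) * F t)) ⟩
  bit (T zero) * F zero + sum (map (λ t → bit (T (suc t)) * F (suc t)) (allFin k))
    ≡⟨ cong₂ _+_ (head (T zero) refl) (sum-over-subset (T ∘ suc) (F ∘ suc) C (F≡C ∘ suc)) ⟩
  bit (T zero) * C + size (T ∘ suc) * C
    ≡⟨ *-distribʳ-+ C (bit (T zero)) (size (T ∘ suc)) ⟨
  size T * C ∎
  where
  head : ∀ b → T zero ≡ b → bit b * F zero ≡ bit b * C
  head true  T0 = cong (_+ 0) (F≡C zero T0)
  head false _  = refl

hits : ∀ {L k} → (Fin L → Fin k) → Fin k → Bool
hits g t = does (any? (λ j → g j Fin.≟ t))

HasImage : ∀ {L k} → (Fin L → Fin k) → Subset k → Set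
HasImage g T = ∀ t → hits g t ≡ T t

hasImage? : ∀ {L k} (g : Fin L → Fin k) (T : Subset k) → Dec (HasImage g T)
hasImage? g T = all? (λ t → hits g t Bool.≟ T t)

hasImage-cong : ∀ {L k} {g g′ : Fin L → Fin k} → (∀ j → g j ≡ g′ j) → ∀ T → indicator (hasImage? g T) ≡ indicator (hasImage? g′ T)
hasImage-cong {g = g} {g′} g≗g′ T = indicator-⇔ (hasImage? g T) (hasImage? g′ T)
  (λ im t → trans (sym (same-hits t)) (im t)) (λ im t → trans (same-hits t) (im t))
  where
  same-hits : ∀ t → hits g t ≡ hits g′ t
  same-hits t = does-⇔ (any? (λ j → g j Fin.≟ t)) (any? (λ j → g′ j Fin.≟ t))
    (λ { (j , gj≡t) → j , trans (sym (g≗g′ j)) gj≡t }) (λ { (j , g′j≡t) → j , trans (g≗g′ j) g′j≡t })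

sum-allFuns-suc : ∀ L k (F : (Fin (suc L) → Fin k) → ℕ) → (∀ {g g′} → (∀ j → g j ≡ g′ j) → F g ≡ F g′) →
  sum (map F (allFuns (suc L) k)) ≡ sum (map (λ f → sum (map (λ t₀ → F (t₀ ∷ᶠ f)) (allFin k))) (allFuns L k))
sum-allFuns-suc L k F F-cong = trans (sum-map-concatMap F _ (allFuns L k)) (sum-map-cong (allFuns L k) (λ f →
  trans (cong sum (sym (map-∘ (allFin k)))) (sum-map-cong (allFin k) (λ t₀ → F-cong (λ { zero → refl ; (suc j) → refl })))))

module FirstValue {L k} (g : Fin (suc L) → Fin k) where

  t₀ : Fin k
  t₀ = g zero

  hits-first : hits g t₀ ≡ true
  hits-first rewrite dec-true (t₀ Fin.≟ t₀) refl = refl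

  hits-rest : ∀ {t} → t₀ ≢ t → hits g t ≡ hits (g ∘ suc) t
  hits-rest {t} t₀≢t rewrite dec-false (t₀ Fin.≟ t) t₀≢t = refl

  remove-first : ∀ T → remove T t₀ t₀ ≡ false
  remove-first T rewrite dec-true (t₀ Fin.≟ t₀) refl = refl

  remove-rest : ∀ T {t} → t₀ ≢ t → remove T t₀ t ≡ T t
  remove-rest T {t} t₀≢t rewrite dec-false (t Fin.≟ t₀) (t₀≢t ∘ sym) = refl

  -- g has image T iff T contains t₀ and the rest of g has image either T
  -- (if it hits t₀ again) or T minus t₀ (if it does not); the two cases exclude each other.
  indicator-hasImage : ∀ T → indicator (hasImage? g T) ≡
    bit (T t₀) * (indicator (hasImage? (g ∘ suc) T) + indicator (hasImage? (g ∘ suc) (remove T t₀)))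
  indicator-hasImage T = by-values (T t₀) refl (hits (g ∘ suc) t₀) refl
    where
    f = g ∘ suc
    by-values : ∀ b → T t₀ ≡ b → ∀ b′ → hits f t₀ ≡ b′ →
            indicator (hasImage? g T) ≡ bit b * (indicator (hasImage? f T) + indicator (hasImage? f (remove T t₀)))
    by-values false T₀ _ _ = indicator-no (hasImage? g T) (λ im → contradiction (trans (sym hits-first) (trans (im t₀) T₀)) λ ())
    by-values true T₀ true f₀ = begin
      indicator (hasImage? g T) ≡⟨ indicator-⇔ (hasImage? g T) (hasImage? f T) to from ⟩
      indicator (hasImage? f T) ≡⟨ +-identityʳ _ ⟨
      indicator (hasImage? f T) + 0
        ≡⟨ cong (indicator (hasImage? f T) +_) (indicator-no (hasImage? f (remove T t₀)) missed) ⟨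
      indicator (hasImage? f T) + indicator (hasImage? f (remove T t₀)) ≡⟨ +-identityʳ _ ⟨
      bit true * (indicator (hasImage? f T) + indicator (hasImage? f (remove T t₀))) ∎
      where
      missed : ¬ HasImage f (remove T t₀)
      missed im with trans (sym f₀) (trans (im t₀) (remove-first T))
      ... | ()
      to : HasImage g T → HasImage f T
      to im t with toSum (t₀ Fin.≟ t)
      ... | inj₁ refl = trans f₀ (sym T₀)
      ... | inj₂ t₀≢t = trans (sym (hits-rest t₀≢t)) (im t)
      from : HasImage f T → HasImage g T
      from im t with toSum (t₀ Fin.≟ t)
      ... | inj₁ refl = trans hits-first (sym T₀)
      ... | inj₂ t₀≢t = trans (hits-rest t₀≢t) (im t)
    by-values true T₀ false f₀ = begin
      indicator (hasImage? g T)                  ≡⟨ indicator-⇔ (hasImage? g T) (hasImage? f (remove T t₀)) to from ⟩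
      indicator (hasImage? f (remove T t₀))      ≡⟨ cong (_+ indicator (hasImage? f (remove T t₀))) (indicator-no (hasImage? f T) missed) ⟨
      indicator (hasImage? f T) + indicator (hasImage? f (remove T t₀)) ≡⟨ +-identityʳ _ ⟨
      bit true * (indicator (hasImage? f T) + indicator (hasImage? f (remove T t₀))) ∎
      where
      missed : ¬ HasImage f T
      missed im with trans (sym f₀) (trans (im t₀) T₀)
      ... | ()
      to : HasImage g T → HasImage f (remove T t₀)
      to im t with toSum (t₀ Fin.≟ t)
      ... | inj₁ refl = trans f₀ (sym (remove-first T))
      ... | inj₂ t₀≢t = trans (sym (hits-rest t₀≢t)) (trans (im t) (sym (remove-rest T t₀≢t)))
      from : HasImage f (remove T t₀) → HasImage g T
      from im t with toSum (t₀ Fin.≟ t)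
      ... | inj₁ refl = trans hits-first (sym T₀)
      ... | inj₂ t₀≢t = trans (hits-rest t₀≢t) (trans (im t) (remove-rest T t₀≢t))

-- The ordered Stirling numbers t ! S(L,t) satisfy the recurrence obtained by
-- choosing the value of the first point and then mapping the remaining L points
-- onto either the whole t-set or the other t - 1 points.
ordered-stirling-rec : ∀ L s → suc s ! * S₂ (suc L) (suc s) ≡ suc s * (suc s ! * S₂ L (suc s) + s ! * S₂ L s)
ordered-stirling-rec L s = lemma s (s !) (S₂ L (suc s)) (S₂ L s)
  where
  open import Data.Nat.Solver using (module +-*-Solver)
  open +-*-Solver
  lemma : ∀ n f a b → suc n * f * (suc n * a + b) ≡ suc n * (suc n * f * a + f * b)
  lemma = solve 4 (λ n f a b → (con 1 :+ n) :* f :* ((con 1 :+ n) :* a :+ b)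
                              := (con 1 :+ n) :* ((con 1 :+ n) :* f :* a :+ f :* b)) refl

ontoCount : ∀ {k} → ℕ → Subset k → ℕ
ontoCount L T = size T ! * S₂ L (size T)

ontoCount-first-value : ∀ L {k} (T : Subset k) →
  sum (map (λ t₀ → bit (T t₀) * (ontoCount L T + ontoCount L (remove T t₀))) (allFin k)) ≡ ontoCount (suc L) T
ontoCount-first-value L {k} T = by-size (size T) refl
  where
  by-size : ∀ s → size T ≡ s →
    sum (map (λ t₀ → bit (T t₀) * (ontoCount L T + ontoCount L (remove T t₀))) (allFin k)) ≡ s ! * S₂ (suc L) s
  by-size zero |T| = trans (sum-over-subset T _ 0 (λ t Tt → contradiction (trans (sym Tt) (size-zero⇒empty T |T| t)) λ ()))
                           (*-zeroʳ (size T))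
  by-size (suc s) |T| = begin
    sum (map (λ t₀ → bit (T t₀) * (ontoCount L T + ontoCount L (remove T t₀))) (allFin k))
      ≡⟨ sum-over-subset T _ (ontoCount L T + s ! * S₂ L s)
           (λ t₀ Tt₀ → cong (λ u → ontoCount L T + u ! * S₂ L u) (suc-injective (trans (size-remove T t₀ Tt₀) |T|))) ⟩
    size T * (ontoCount L T + s ! * S₂ L s)
      ≡⟨ cong (λ u → u * (u ! * S₂ L u + s ! * S₂ L s)) |T| ⟩
    suc s * (suc s ! * S₂ L (suc s) + s ! * S₂ L s)
      ≡⟨ ordered-stirling-rec L s ⟨
    suc s ! * S₂ (suc L) (suc s) ∎

count-image : ∀ L k (T : Subset k) → count (λ g → hasImage? g T) (allFuns L k) ≡ ontoCount L T
count-image zero k T = trans (count-∷ (λ g → hasImage? g T) _ []) (trans (+-identityʳ _) (empty-function (λ ())))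
  where
  empty-function : (g : Fin 0 → Fin k) → indicator (hasImage? g T) ≡ ontoCount 0 T
  empty-function g with size T in |T|
  ... | zero  = indicator-yes (hasImage? g T) (λ t → sym (size-zero⇒empty T |T| t))
  ... | suc s = trans (indicator-no (hasImage? g T) (λ im → 0≢1+n (trans (sym (empty⇒size-zero T (λ t → sym (im t)))) |T|)))
                      (sym (*-zeroʳ (suc s !)))
count-image (suc L) k T = begin
  count (λ g → hasImage? g T) (allFuns (suc L) k)
    ≡⟨ count≡sum (λ g → hasImage? g T) (allFuns (suc L) k) ⟩
  sum (map (λ g → I g T) (allFuns (suc L) k))
    ≡⟨ sum-allFuns-suc L k (λ g → I g T) (λ g≗g′ → hasImage-cong g≗g′ T) ⟩
  sum (map (λ f → sum (map (λ t₀ → I (t₀ ∷ᶠ f) T) (allFin k))) (allFuns L k))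
    ≡⟨ sum-map-cong (allFuns L k) (λ f → sum-map-cong (allFin k) (λ t₀ → FirstValue.indicator-hasImage (t₀ ∷ᶠ f) T)) ⟩
  sum (map (λ f → sum (map (λ t₀ → bit (T t₀) * (I f T + I f (remove T t₀))) (allFin k))) (allFuns L k))
    ≡⟨ sum-map-swap (λ f t₀ → bit (T t₀) * (I f T + I f (remove T t₀))) (allFuns L k) (allFin k) ⟩
  sum (map (λ t₀ → sum (map (λ f → bit (T t₀) * (I f T + I f (remove T t₀))) (allFuns L k))) (allFin k))
    ≡⟨ sum-map-cong (allFin k) rest-of-map ⟩
  sum (map (λ t₀ → bit (T t₀) * (ontoCount L T + ontoCount L (remove T t₀))) (allFin k))
    ≡⟨ ontoCount-first-value L T ⟩
  ontoCount (suc L) T ∎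
  where
  I : ∀ {M} → (Fin M → Fin k) → Subset k → ℕ
  I f U = indicator (hasImage? f U)
  count-rest : ∀ U → sum (map (λ f → I f U) (allFuns L k)) ≡ ontoCount L U
  count-rest U = trans (sym (count≡sum (λ f → hasImage? f U) (allFuns L k))) (count-image L k U)
  rest-of-map : ∀ t₀ → sum (map (λ f → bit (T t₀) * (I f T + I f (remove T t₀))) (allFuns L k))
                       ≡ bit (T t₀) * (ontoCount L T + ontoCount L (remove T t₀))
  rest-of-map t₀ = begin
    sum (map (λ f → bit (T t₀) * (I f T + I f (remove T t₀))) (allFuns L k))
      ≡⟨ sum-map-*ˡ (bit (T t₀)) _ (allFuns L k) ⟩
    bit (T t₀) * sum (map (λ f → I f T + I f (remove T t₀)) (allFuns L k))
      ≡⟨ cong (bit (T t₀) *_) (sum-map-+ (λ f → I f T) _ (allFuns L k)) ⟩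
    bit (T t₀) * (sum (map (λ f → I f T) (allFuns L k)) + sum (map (λ f → I f (remove T t₀)) (allFuns L k)))
      ≡⟨ cong (bit (T t₀) *_) (cong₂ _+_ (count-rest T) (count-rest (remove T t₀))) ⟩
    bit (T t₀) * (ontoCount L T + ontoCount L (remove T t₀)) ∎

count-surjections : ∀ L k → count isSurj? (allFuns L k) ≡ k ! * S₂ L k
count-surjections L k = begin
  count isSurj? (allFuns L k)
    ≡⟨ count-⇔ isSurj? (λ g → hasImage? g full) (λ g onto t → dec-true (any? (λ j → g j Fin.≟ t)) (onto t))
                                               (λ g im t → from-does (any? (λ j → g j Fin.≟ t)) (im t)) (allFuns L k) ⟩
  count (λ g → hasImage? g full) (allFuns L k)
    ≡⟨ count-image L k full ⟩
  ontoCount L full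
    ≡⟨ cong (λ u → u ! * S₂ L u) (size-full k) ⟩
  k ! * S₂ L k ∎
  where
  full : Subset k
  full _ = true
  from-does : ∀ {P : Set} (p : Dec P) → does p ≡ true → P
  from-does (yes p) _ = p

module _ {A : Set} where

  unique-↭ : {xs ys : List A} → xs ↭ ys → Unique xs → Unique ys
  unique-↭ xs↭ys = Permutationₛ.Unique-resp-↭ (setoid A) (↭⇒↭ₛ xs↭ys)

  unique-same-members⇒↭ : {xs ys : List A} → Unique xs → Unique ys →
                          (∀ {z} → z ∈ xs → z ∈ ys) → (∀ {z} → z ∈ ys → z ∈ xs) → xs ↭ ys
  unique-same-members⇒↭ uxs uys to from = ∼bag⇒↭ (unique∧set⇒bag uxs uys (mk⇔ to from))

  ∈⇒↭∷ : {x : A} {xs : List A} → x ∈ xs → ∃ λ xs′ → xs ↭ x ∷ xs′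
  ∈⇒↭∷ x∈ with ∈-∃++ x∈
  ... | as , bs , refl = as ++ bs , shift _ as bs

  unique-⊆-length : {ys xs : List A} → Unique ys → (∀ {z} → z ∈ ys → z ∈ xs) → length ys ≤ length xs
  unique-⊆-length {[]}     _            _   = z≤n
  unique-⊆-length {y ∷ ys} (y∉ys ∷ uys) sub with ∈⇒↭∷ (sub (here refl))
  ... | xs′ , xs↭ = ≤-trans (s≤s (unique-⊆-length uys sub′)) (≤-reflexive (sym (↭-length xs↭)))
    where
    sub′ : ∀ {z} → z ∈ ys → z ∈ xs′
    sub′ z∈ with ∈-resp-↭ xs↭ (sub (there z∈))
    ... | here z≡y   = ⊥-elim (All.lookup y∉ys z∈ (sym z≡y))
    ... | there z∈xs′ = z∈xs′

  case-∷ : ∀ {z x : A} {xs} {B : Set} → z ∈ x ∷ xs → (z ≡ x → B) → (z ∈ xs → B) → B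
  case-∷ (here z≡x) f _ = f z≡x
  case-∷ (there z∈) _ g = g z∈

  ⊆-unique : DecidableEquality A → {ys xs : List A} → Unique ys → (∀ {z} → z ∈ ys → z ∈ xs) →
             length xs ≤ length ys → Unique xs
  ⊆-unique _≟_ {ys} {[]}     _   _   _   = []
  ⊆-unique _≟_ {ys} {x ∷ xs} uys sub len = by-cases (Any.any? (x ≟_) xs) (Any.any? (x ≟_) ys)
    where
    too-long : (∀ {z} → z ∈ ys → z ∈ xs) → ⊥
    too-long ys⊆xs = <⇒≱ len (unique-⊆-length uys ys⊆xs)
    by-cases : Dec (x ∈ xs) → Dec (x ∈ ys) → Unique (x ∷ xs)
    by-cases (yes x∈xs) _ = ⊥-elim (too-long λ z∈ → case-∷ (sub z∈) (λ z≡x → subst (_∈ xs) (sym z≡x) x∈xs) (λ z∈xs → z∈xs))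
    by-cases (no x∉xs) (no x∉ys) = ⊥-elim (too-long λ z∈ → case-∷ (sub z∈) (λ z≡x → ⊥-elim (x∉ys (subst (_∈ ys) z≡x z∈))) (λ z∈xs → z∈xs))
    by-cases (no x∉xs) (yes x∈ys) with ∈⇒↭∷ x∈ys
    ... | ys′ , ys↭ with unique-↭ ys↭ uys
    ...   | x∉ys′ ∷ uys′ = All.tabulate (λ z∈ x≡z → x∉xs (subst (_∈ xs) (sym x≡z) z∈))
                         ∷ ⊆-unique _≟_ uys′ sub′ (≤-pred (≤-trans len (≤-reflexive (↭-length ys↭))))
      where
      sub′ : ∀ {z} → z ∈ ys′ → z ∈ xs
      sub′ z∈ = case-∷ (sub (∈-resp-↭ (↭-sym ys↭) (there z∈))) (λ z≡x → ⊥-elim (All.lookup x∉ys′ z∈ (sym z≡x))) (λ z∈xs → z∈xs)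

  classes-↭ : ∀ {ℓ} (c : A → Fin ℓ) {xs : List A} → Unique xs →
              concatMap (λ t → filter (λ x → c x Fin.≟ t) xs) (allFin ℓ) ↭ xs
  classes-↭ {ℓ} c {xs} uxs = unique-same-members⇒↭ unique-classes uxs
    (λ z∈ → proj₁ (∈-filter⁻ (class? _) (proj₂ (Any.satisfied (∈-concatMap⁻ _ {xs = allFin ℓ} z∈)))))
    (λ {z} z∈ → ∈-concatMap⁺ _ (Any.map (λ c≡t → ∈-filter⁺ (class? _) z∈ c≡t) (∈-allFin (c z))))
    where
    class? = λ t x → c x Fin.≟ t
    class = λ t → filter (class? t) xs
    unique-classes : Unique (concatMap class (allFin ℓ))
    unique-classes = Unique.concat⁺
      (Allₚ.map⁺ (All.universal (λ t → Unique.filter⁺ (class? t) uxs) (allFin ℓ)))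
      (AllPairsₚ.map⁺ (AllPairs.map (λ {t} {t′} t≢t′ {_} (z∈t , z∈t′) →
         t≢t′ (trans (sym (proj₂ (∈-filter⁻ (class? t) {xs = xs} z∈t))) (proj₂ (∈-filter⁻ (class? t′) {xs = xs} z∈t′))))
         (Unique.allFin⁺ ℓ)))

unique-++ˡ : ∀ {A : Set} (xs : List A) {ys} → Unique (xs ++ ys) → Unique xs
unique-++ˡ []       _        = []
unique-++ˡ (x ∷ xs) (x∉ ∷ u) = Allₚ.++⁻ˡ xs x∉ ∷ unique-++ˡ xs u

unique-++-disjoint : ∀ {A : Set} (xs : List A) {ys z} → Unique (xs ++ ys) → z ∈ xs → z ∈ ys → ⊥
unique-++-disjoint (x ∷ xs) (x∉ ∷ _) (here refl) z∈ys = All.lookup (Allₚ.++⁻ʳ xs x∉) z∈ys refl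
unique-++-disjoint (x ∷ xs) (_ ∷ u)  (there z∈) z∈ys = unique-++-disjoint xs u z∈ z∈ys

unique-++ʳ : ∀ {A : Set} (xs : List A) {ys} → Unique (xs ++ ys) → Unique ys
unique-++ʳ []       u       = u
unique-++ʳ (x ∷ xs) (_ ∷ u) = unique-++ʳ xs u

map-unique : ∀ {A B : Set} (f : A → B) {X} → Unique X → (∀ {a b} → a ∈ X → b ∈ X → f a ≡ f b → a ≡ b) → Unique (map f X)
map-unique f {[]}    []          _   = []
map-unique f {a ∷ X} (a∉X ∷ uX) inj =
  Allₚ.map⁺ (All.tabulate (λ {b} b∈ fa≡fb → All.lookup a∉X b∈ (inj (here refl) (there b∈) fa≡fb)))
  ∷ map-unique f uX (λ a∈ b∈ → inj (there a∈) (there b∈))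

EndsAt : ℕ → ℕ → Edge → Set
EndsAt i h e = (ex e ≡ i × ea e ≡ h) ⊎ (ey e ≡ i × eb e ≡ h)

heights-++ : ∀ i A B → heights i (A ++ B) ≡ heights i A ++ heights i B
heights-++ i A B = concatMap-++ _ A B

heights-single⁺ : ∀ i h e → EndsAt i h e → h ∈ heights i [ e ]
heights-single⁺ i h (x , y , a , b) at with x ≟ i | y ≟ i
heights-single⁺ i h (x , y , a , b) (inj₁ (_ , refl)) | yes _ | _     = here refl
heights-single⁺ i h (x , y , a , b) (inj₁ (x≡i , _))  | no x≢i | _    = ⊥-elim (x≢i x≡i)
heights-single⁺ i h (x , y , a , b) (inj₂ (_ , refl)) | yes _ | yes _ = there (here refl)
heights-single⁺ i h (x , y , a , b) (inj₂ (_ , refl)) | no _  | yes _ = here refl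
heights-single⁺ i h (x , y , a , b) (inj₂ (y≡i , _))  | _     | no y≢i = ⊥-elim (y≢i y≡i)

heights-single⁻ : ∀ i h e → h ∈ heights i [ e ] → EndsAt i h e
heights-single⁻ i h (x , y , a , b) h∈ with x ≟ i | y ≟ i | h∈
... | yes x≡i | _       | here h≡a         = inj₁ (x≡i , sym h≡a)
... | yes _   | yes y≡i | there (here h≡b) = inj₂ (y≡i , sym h≡b)
... | no _    | yes y≡i | here h≡b         = inj₂ (y≡i , sym h≡b)

∈heights⁺ : ∀ {i h e X} → e ∈ X → EndsAt i h e → h ∈ heights i X
∈heights⁺ {i} {h} {e} {_ ∷ X} (here refl) at = subst (h ∈_) (sym (heights-++ i [ e ] X)) (∈-++⁺ˡ (heights-single⁺ i h e at))
∈heights⁺ {i} {h} {e} {d ∷ X} (there e∈X) at = subst (h ∈_) (sym (heights-++ i [ d ] X)) (∈-++⁺ʳ (heights i [ d ]) (∈heights⁺ e∈X at))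

∈heights⁻ : ∀ {i h} X → h ∈ heights i X → ∃ λ e → e ∈ X × EndsAt i h e
∈heights⁻ {i} {h} (d ∷ X) h∈ with ∈-++⁻ (heights i [ d ]) (subst (h ∈_) (heights-++ i [ d ] X) h∈)
... | inj₁ h∈d = d , here refl , heights-single⁻ i h d h∈d
... | inj₂ h∈X with ∈heights⁻ X h∈X
...   | e , e∈X , at = e , there e∈X , at

∈heights-++⁻ : ∀ {i h} A B → h ∈ heights i (A ++ B) → h ∈ heights i A ⊎ h ∈ heights i B
∈heights-++⁻ {i} {h} A B h∈ = ∈-++⁻ (heights i A) (subst (h ∈_) (heights-++ i A B) h∈)

onPeg? : (i : ℕ) (e : Edge) → Dec ((ex e ≡ i) ⊎ (ey e ≡ i))
onPeg? i e = (ex e ≟ i) ⊎-dec (ey e ≟ i)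

p-∷ : ∀ i e X → p i (e ∷ X) ≡ indicator (onPeg? i e) + p i X
p-∷ i e X = count-∷ (onPeg? i) e X

p-++ : ∀ i A B → p i (A ++ B) ≡ p i A + p i B
p-++ i A B = trans (cong length (filter-++ (onPeg? i) A B)) (length-++ (filter (onPeg? i) A))

p-↭ : ∀ i {A B} → A ↭ B → p i A ≡ p i B
p-↭ i A↭B = ↭-length (filter-↭ (onPeg? i) A↭B)

Loopless : Diagram → Set
Loopless X = All (λ e → ex e ≢ ey e) X

-- Without loops, every edge on peg i contributes exactly one height there.
length-heights : ∀ i {X} → Loopless X → length (heights i X) ≡ p i X
length-heights i {[]}    []               = refl
length-heights i {e ∷ X} (x≢y ∷ loopless) = begin
  length (heights i (e ∷ X))                     ≡⟨ cong length (heights-++ i [ e ] X) ⟩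
  length (heights i [ e ] ++ heights i X)        ≡⟨ length-++ (heights i [ e ]) ⟩
  length (heights i [ e ]) + length (heights i X) ≡⟨ cong₂ _+_ (single e x≢y) (length-heights i loopless) ⟩
  indicator (onPeg? i e) + p i X                 ≡⟨ p-∷ i e X ⟨
  p i (e ∷ X) ∎
  where
  single : ∀ e → ex e ≢ ey e → length (heights i [ e ]) ≡ indicator (onPeg? i e)
  single (x , y , a , b) x≢y with x ≟ i | y ≟ i
  ... | yes x≡i | yes y≡i = ⊥-elim (x≢y (trans x≡i (sym y≡i)))
  ... | yes x≡i | no _    = sym (indicator-yes (onPeg? i (x , y , a , b)) (inj₁ x≡i))
  ... | no _    | yes y≡i = sym (indicator-yes (onPeg? i (x , y , a , b)) (inj₂ y≡i))
  ... | no x≢i  | no y≢i  = sym (indicator-no (onPeg? i (x , y , a , b)) [ x≢i , y≢i ]′)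

-- atMost h xs : the number of entries of xs that are at most h;
-- by definition rank i h X = atMost h (heights i X).
atMost : ℕ → List ℕ → ℕ
atMost h xs = count (λ h′ → h′ ≤? h) xs

indicator-mono : {P Q : Set} (p : Dec P) (q : Dec Q) → (P → Q) → indicator p ≤ indicator q
indicator-mono (yes a) (yes _) _  = ≤-refl
indicator-mono (yes a) (no ¬b) to = ⊥-elim (¬b (to a))
indicator-mono (no _)  _       _  = z≤n

atMost-pos : ∀ {h} xs → h ∈ xs → 1 ≤ atMost h xs
atMost-pos {h} (x ∷ xs) (here refl) rewrite count-∷ (λ h′ → h′ ≤? h) x xs | indicator-yes (x ≤? x) (≤-refl {x}) = s≤s z≤n
atMost-pos {h} (x ∷ xs) (there h∈) rewrite count-∷ (λ h′ → h′ ≤? h) x xs = ≤-trans (atMost-pos xs h∈) (m≤n+m _ _)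

atMost-mono : ∀ {h h′} xs → h ≤ h′ → atMost h xs ≤ atMost h′ xs
atMost-mono [] _ = z≤n
atMost-mono {h} {h′} (x ∷ xs) h≤h′ rewrite count-∷ (λ u → u ≤? h) x xs | count-∷ (λ u → u ≤? h′) x xs =
  +-mono-≤ (indicator-mono (x ≤? h) (x ≤? h′) (λ x≤h → ≤-trans x≤h h≤h′)) (atMost-mono xs h≤h′)

atMost-strict : ∀ {h h′} xs → h < h′ → h′ ∈ xs → atMost h xs < atMost h′ xs
atMost-strict {h} {h′} (x ∷ xs) h<h′ (here refl)
  rewrite count-∷ (λ u → u ≤? h) x xs | count-∷ (λ u → u ≤? h′) x xs
        | indicator-no (x ≤? h) (<⇒≱ h<h′) | indicator-yes (x ≤? x) (≤-refl {x}) = s≤s (atMost-mono xs (<⇒≤ h<h′))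
atMost-strict {h} {h′} (x ∷ xs) h<h′ (there h′∈) rewrite count-∷ (λ u → u ≤? h) x xs | count-∷ (λ u → u ≤? h′) x xs =
  +-mono-≤-< (indicator-mono (x ≤? h) (x ≤? h′) (λ x≤h → ≤-trans x≤h (<⇒≤ h<h′))) (atMost-strict xs h<h′ h′∈)

atMost-injective : ∀ {h h′} xs → h ∈ xs → h′ ∈ xs → atMost h xs ≡ atMost h′ xs → h ≡ h′
atMost-injective {h} {h′} xs h∈ h′∈ eq with <-cmp h h′
... | tri< h<h′ _ _ = ⊥-elim (<⇒≢ (atMost-strict xs h<h′ h′∈) eq)
... | tri≈ _ h≡h′ _ = h≡h′
... | tri> _ _ h>h′ = ⊥-elim (<⇒≢ (atMost-strict xs h>h′ h∈) (sym eq))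

rank-pos : ∀ {i h} C → h ∈ heights i C → 1 ≤ rank i h C
rank-pos {i} C h∈ = atMost-pos (heights i C) h∈

rank-≤ : ∀ {i} h {C} → Loopless C → rank i h C ≤ p i C
rank-≤ {i} h {C} loopless = ≤-trans (length-filter (λ h′ → h′ ≤? h) (heights i C)) (≤-reflexive (length-heights i loopless))

relabel : (ℕ → ℕ → ℕ) → Edge → Edge
relabel σ (x , y , a , b) = (x , y , σ x a , σ y b)

p-relabel : ∀ i σ X → p i (map (relabel σ) X) ≡ p i X
p-relabel i σ []      = refl
p-relabel i σ (e ∷ X) = trans (p-∷ i (relabel σ e) (map (relabel σ) X))
                              (trans (cong (indicator (onPeg? i e) +_) (p-relabel i σ X)) (sym (p-∷ i e X)))

endsAt-relabel⁺ : ∀ σ {i h} e → EndsAt i h e → EndsAt i (σ i h) (relabel σ e)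
endsAt-relabel⁺ σ e (inj₁ (refl , refl)) = inj₁ (refl , refl)
endsAt-relabel⁺ σ e (inj₂ (refl , refl)) = inj₂ (refl , refl)

endsAt-relabel⁻ : ∀ σ {i h} e → EndsAt i h (relabel σ e) → ∃ λ h₀ → EndsAt i h₀ e × σ i h₀ ≡ h
endsAt-relabel⁻ σ (x , y , a , b) (inj₁ (refl , σa≡h)) = a , inj₁ (refl , refl) , σa≡h
endsAt-relabel⁻ σ (x , y , a , b) (inj₂ (refl , σb≡h)) = b , inj₂ (refl , refl) , σb≡h

∈heights-relabel : ∀ σ {i h} X → h ∈ heights i X → σ i h ∈ heights i (map (relabel σ) X)
∈heights-relabel σ X h∈ with ∈heights⁻ X h∈
... | e , e∈X , at = ∈heights⁺ (∈-map⁺ (relabel σ) e∈X) (endsAt-relabel⁺ σ e at)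

SlotInjective : Diagram → Set
SlotInjective X = ∀ {d d′ i h} → d ∈ X → d′ ∈ X → EndsAt i h d → EndsAt i h d′ → d ≡ d′

InjectiveOnHeights : (ℕ → ℕ → ℕ) → Diagram → Set
InjectiveOnHeights σ X = ∀ {i h h′} → h ∈ heights i X → h′ ∈ heights i X → σ i h ≡ σ i h′ → h ≡ h′

relabel-injective : ∀ {σ X} → SlotInjective X → InjectiveOnHeights σ X →
                    ∀ {d d′} → d ∈ X → d′ ∈ X → relabel σ d ≡ relabel σ d′ → d ≡ d′
relabel-injective slots inj {x , y , a , b} {x′ , y′ , a′ , b′} d∈ d′∈ eq with cong ex eq
... | refl with inj (∈heights⁺ d∈ (inj₁ (refl , refl))) (∈heights⁺ d′∈ (inj₁ (refl , refl))) (cong ea eq)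
... | refl = slots d∈ d′∈ (inj₁ (refl , refl)) (inj₁ (refl , refl))

slotInjective-relabel : ∀ {σ X} → SlotInjective X → InjectiveOnHeights σ X → SlotInjective (map (relabel σ) X)
slotInjective-relabel {σ} {X} slots inj d∈ d′∈ at at′
  with ∈-map⁻ (relabel σ) d∈ | ∈-map⁻ (relabel σ) d′∈
... | d₀ , d₀∈ , refl | d₀′ , d₀′∈ , refl
  with endsAt-relabel⁻ σ d₀ at | endsAt-relabel⁻ σ d₀′ at′
... | h₀ , at₀ , σh₀ | h₀′ , at₀′ , σh₀′
  with inj (∈heights⁺ d₀∈ at₀) (∈heights⁺ d₀′∈ at₀′) (trans σh₀ (sym σh₀′))
... | refl = cong (relabel σ) (slots d₀∈ d₀′∈ at₀ at₀′)

unique-relabel : ∀ {σ X} → Unique X → SlotInjective X → InjectiveOnHeights σ X → Unique (map (relabel σ) X)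
unique-relabel {σ} uX slots inj = map-unique (relabel σ) uX (relabel-injective slots inj)

-- The heights obtained after stacking C on top of Y: heights of Y keep
-- their value under σ, heights of C are replaced by their rank in C,
-- shifted above the p i Y endpoints already on peg i.
stackOn : (ℕ → ℕ → ℕ) → Diagram → Diagram → ℕ → ℕ → ℕ
stackOn σ Y C i h = if does (h ∈? heights i Y) then σ i h else rank i h C + p i Y

stackOn-old : ∀ σ Y C {i h} → h ∈ heights i Y → stackOn σ Y C i h ≡ σ i h
stackOn-old σ Y C {i} {h} h∈ rewrite dec-true (h ∈? heights i Y) h∈ = refl

stackOn-new : ∀ σ Y C {i h} → h ∉ heights i Y → stackOn σ Y C i h ≡ rank i h C + p i Y
stackOn-new σ Y C {i} {h} h∉ rewrite dec-false (h ∈? heights i Y) h∉ = refl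

-- Stacked Y acc σ : acc is, up to order, Y relabelled by σ, and σ i
-- maps the heights of Y on peg i injectively into 1 … p i Y.
record Stacked (Y acc : Diagram) (σ : ℕ → ℕ → ℕ) : Set where
  field
    arrangement : acc ↭ map (relabel σ) Y
    in-range    : ∀ {i h} → h ∈ heights i Y → 1 ≤ σ i h × σ i h ≤ p i Y
    injective   : InjectiveOnHeights σ Y

stacked-[] : Stacked [] [] (λ _ h → h)
stacked-[] = record { arrangement = ↭-refl ; in-range = λ () ; injective = λ () }

FreshOver : Diagram → Diagram → Set
FreshOver Y C = ∀ {e i h} → e ∈ C → EndsAt i h e → h ∉ heights i Y

module StackStep {Y acc : Diagram} {σ : ℕ → ℕ → ℕ} (C : Diagram)
                 (st : Stacked Y acc σ) (fresh : FreshOver Y C) (loopless : Loopless C) where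

  open Stacked st

  σ′ : ℕ → ℕ → ℕ
  σ′ = stackOn σ Y C

  -- acc has as many endpoints on each peg as Y, so rel C is shifted by p i Y.
  p-acc : ∀ i → p i acc ≡ p i Y
  p-acc i = trans (p-↭ i arrangement) (p-relabel i σ Y)

  old-edges : map (relabel σ) Y ≡ map (relabel σ′) Y
  old-edges = map-cong-local (All.tabulate λ { {x , y , a , b} e∈ →
    cong₂ (λ u v → (x , y , u , v)) (sym (stackOn-old σ Y C (∈heights⁺ e∈ (inj₁ (refl , refl)))))
                                     (sym (stackOn-old σ Y C (∈heights⁺ e∈ (inj₂ (refl , refl))))) })

  placed : acc ⊕ rel C ≡ acc ++ map (relabel σ′) C
  placed = cong (acc ++_) (trans (sym (map-∘ C)) (map-cong-local (All.tabulate λ { {x , y , a , b} e∈ →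
    cong₂ (λ u v → (x , y , u , v))
      (trans (cong (rank x a C +_) (p-acc x)) (sym (stackOn-new σ Y C (fresh e∈ (inj₁ (refl , refl))))))
      (trans (cong (rank y b C +_) (p-acc y)) (sym (stackOn-new σ Y C (fresh e∈ (inj₂ (refl , refl)))))) })))

  arrangement′ : acc ⊕ rel C ↭ map (relabel σ′) (Y ++ C)
  arrangement′ = ↭-trans (↭-reflexive placed)
                 (↭-trans (++⁺ʳ (map (relabel σ′) C) (↭-trans arrangement (↭-reflexive old-edges)))
                          (↭-reflexive (sym (map-++ (relabel σ′) Y C))))

  data Side (i h : ℕ) : Set where
    old : h ∈ heights i Y → Side i h
    new : h ∉ heights i Y → h ∈ heights i C → Side i h

  side : ∀ {i h} → h ∈ heights i (Y ++ C) → Side i h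
  side {i} {h} h∈ with h ∈? heights i Y | ∈heights-++⁻ Y C h∈
  ... | yes h∈Y | _        = old h∈Y
  ... | no h∉Y  | inj₁ h∈Y = ⊥-elim (h∉Y h∈Y)
  ... | no h∉Y  | inj₂ h∈C = new h∉Y h∈C

  InRange : ℕ → ℕ → Set
  InRange i v = 1 ≤ v × v ≤ p i (Y ++ C)

  old-in-range : ∀ {i h} → h ∈ heights i Y → InRange i (σ i h)
  old-in-range {i} h∈Y = proj₁ (in-range h∈Y) ,
    ≤-trans (proj₂ (in-range h∈Y)) (≤-trans (m≤m+n (p i Y) (p i C)) (≤-reflexive (sym (p-++ i Y C))))

  new-in-range : ∀ {i h} → h ∈ heights i C → InRange i (rank i h C + p i Y)
  new-in-range {i} {h} h∈C = ≤-trans (rank-pos C h∈C) (m≤m+n _ _) ,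
    ≤-trans (+-monoˡ-≤ (p i Y) (rank-≤ h loopless)) (≤-reflexive (trans (+-comm (p i C) (p i Y)) (sym (p-++ i Y C))))

  old<new : ∀ {i h h′} → h ∈ heights i Y → h′ ∈ heights i C → σ i h < rank i h′ C + p i Y
  old<new {i} h∈Y h′∈C = ≤-trans (s≤s (proj₂ (in-range h∈Y))) (+-monoˡ-≤ (p i Y) (rank-pos C h′∈C))

  in-range′ : ∀ {i h} → h ∈ heights i (Y ++ C) → InRange i (σ′ i h)
  in-range′ {i} h∈ with side h∈
  ... | old h∈Y     = subst (InRange i) (sym (stackOn-old σ Y C h∈Y)) (old-in-range h∈Y)
  ... | new h∉Y h∈C = subst (InRange i) (sym (stackOn-new σ Y C h∉Y)) (new-in-range h∈C)

  -- Old heights are separated by σ, new ones by their ranks, and old lie below new.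
  injective′ : InjectiveOnHeights σ′ (Y ++ C)
  injective′ {i} h∈ h′∈ eq with side h∈ | side h′∈
  ... | old h∈Y | old h′∈Y = injective h∈Y h′∈Y
        (trans (sym (stackOn-old σ Y C h∈Y)) (trans eq (stackOn-old σ Y C h′∈Y)))
  ... | old h∈Y | new h′∉Y h′∈C = ⊥-elim (<⇒≢ (old<new h∈Y h′∈C)
        (trans (sym (stackOn-old σ Y C h∈Y)) (trans eq (stackOn-new σ Y C h′∉Y))))
  ... | new h∉Y h∈C | old h′∈Y = ⊥-elim (<⇒≢ (old<new h′∈Y h∈C)
        (trans (sym (stackOn-old σ Y C h′∈Y)) (trans (sym eq) (stackOn-new σ Y C h∉Y))))
  ... | new h∉Y h∈C | new h′∉Y h′∈C = atMost-injective (heights i C) h∈C h′∈C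
        (+-cancelʳ-≡ _ _ _ (trans (sym (stackOn-new σ Y C h∉Y)) (trans eq (stackOn-new σ Y C h′∉Y))))

stack-step : ∀ {Y acc σ} C → Stacked Y acc σ → FreshOver Y C → Loopless C →
             Stacked (Y ++ C) (acc ⊕ rel C) (stackOn σ Y C)
stack-step C st fresh loopless = record
  { arrangement = arrangement′ ; in-range = in-range′ ; injective = injective′ }
  where open StackStep C st fresh loopless

module StackAll (E : Diagram) (slots : SlotInjective E) (loopless : Loopless E) {T : Set} (cls : T → Diagram) where

  -- Place rel (cls t) on top of acc for each t ∈ ts in turn; the reconstruction
  -- of a diagram is stackAll [] applied to its colour classes.
  stackAll : Diagram → List T → Diagram
  stackAll acc ts = foldl (λ acc t → acc ⊕ rel (cls t)) acc ts

  stack-all : ∀ ts {Y acc σ} → Stacked Y acc σ → Unique (Y ++ concatMap cls ts) →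
              (∀ {e} → e ∈ Y ++ concatMap cls ts → e ∈ E) →
              ∃ λ σ′ → Stacked (Y ++ concatMap cls ts) (stackAll acc ts) σ′
  stack-all [] {Y} {acc} {σ} st _ _ = σ , subst (λ Z → Stacked Z acc σ) (sym (++-identityʳ Y)) st
  stack-all (t ∷ ts) {Y} {acc} st u ⊆E with stack-all ts (stack-step (cls t) st fresh loopless-C) u′ ⊆E′
    where
    reassoc = ++-assoc Y (cls t) (concatMap cls ts)
    u′ = subst Unique (sym reassoc) u
    ⊆E′ : ∀ {e} → e ∈ (Y ++ cls t) ++ concatMap cls ts → e ∈ E
    ⊆E′ {e} e∈ = ⊆E (subst (e ∈_) reassoc e∈)
    in-C : ∀ {e} → e ∈ cls t → e ∈ E
    in-C e∈C = ⊆E (∈-++⁺ʳ Y (∈-++⁺ˡ e∈C))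
    loopless-C = All.tabulate (λ e∈C → All.lookup loopless (in-C e∈C))
    fresh : FreshOver Y (cls t)
    fresh e∈C at h∈Y with ∈heights⁻ Y h∈Y
    ... | d , d∈Y , at′ = unique-++-disjoint Y (unique-++ˡ (Y ++ cls t) u′) d∈Y
                            (subst (_∈ cls t) (slots (in-C e∈C) (⊆E (∈-++⁺ˡ d∈Y)) at at′) e∈C)
  ... | σ′ , st′ = σ′ , subst (λ Z → Stacked Z _ σ′) (++-assoc Y (cls t) (concatMap cls ts)) st′

unique-heights-∷ : ∀ e X → (∀ i → Unique (heights i (e ∷ X))) → ∀ i → Unique (heights i [ e ] ++ heights i X)
unique-heights-∷ e X unique i = subst Unique (heights-++ i [ e ] X) (unique i)

slots-from-unique-heights : ∀ X → (∀ i → Unique (heights i X)) → SlotInjective X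
slots-from-unique-heights (e ∷ X) unique (here refl) (here refl) _ _ = refl
slots-from-unique-heights (e ∷ X) unique {i = i} (here refl) (there d′∈X) at at′ =
  ⊥-elim (unique-++-disjoint (heights i [ e ]) (unique-heights-∷ e X unique i) (heights-single⁺ i _ e at) (∈heights⁺ d′∈X at′))
slots-from-unique-heights (e ∷ X) unique {i = i} (there d∈X) (here refl) at at′ =
  ⊥-elim (unique-++-disjoint (heights i [ e ]) (unique-heights-∷ e X unique i) (heights-single⁺ i _ e at′) (∈heights⁺ d∈X at))
slots-from-unique-heights (e ∷ X) unique (there d∈X) (there d′∈X) at at′ =
  slots-from-unique-heights X (λ i → unique-++ʳ (heights i [ e ]) (unique-heights-∷ e X unique i)) d∈X d′∈X at at′

loopless-↭ : ∀ {X Y} → X ↭ Y → Loopless Y → Loopless X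
loopless-↭ X↭Y loopless = All.tabulate (λ e∈ → All.lookup loopless (∈-resp-↭ X↭Y e∈))

slotInjective-↭ : ∀ {X Y} → X ↭ Y → SlotInjective Y → SlotInjective X
slotInjective-↭ X↭Y slots d∈ d′∈ = slots (∈-resp-↭ X↭Y d∈) (∈-resp-↭ X↭Y d′∈)

∈heights-↭ : ∀ {i h X Y} → X ↭ Y → h ∈ heights i X → h ∈ heights i Y
∈heights-↭ {X = X} X↭Y h∈ with ∈heights⁻ X h∈
... | e , e∈X , at = ∈heights⁺ (∈-resp-↭ X↭Y e∈X) at

colourClasses-↭ : ∀ E {ℓ} (c : Fin (length E) → Fin ℓ) → Unique E → concatMap (colourClass E c) (allFin ℓ) ↭ E
colourClasses-↭ E {ℓ} c uE =
  subst₂ _↭_ (map-concatMap (lookup E) class (allFin ℓ)) (trans (map-tabulate (λ j → j) (lookup E)) (tabulate-lookup E))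
         (map⁺ (lookup E) (classes-↭ c (Unique.allFin⁺ (length E))))
  where
  class = λ t → Data.List.filter (λ j → c j Fin.≟ t) (allFin (length E))

module WebWorld {n : ℕ} {D : Diagram} (web : IsWeb n D) where

  unique-D : Unique D
  unique-D = proj₁ web

  loopless-D : Loopless D
  loopless-D = All.map (λ bounds → <⇒≢ (proj₁ (proj₂ bounds))) (proj₁ (proj₂ web))

  height-range : ∀ {i h} → h ∈ heights i D → 1 ≤ h × h ≤ p i D
  height-range {i} {h} = Equivalence.to (proj₂ (proj₂ web) i h)

  height-from-range : ∀ {i h} → 1 ≤ h → h ≤ p i D → h ∈ heights i D
  height-from-range {i} {h} 1≤h h≤p = Equivalence.from (proj₂ (proj₂ web) i h) (1≤h , h≤p)

  -- By pigeonhole, peg i carries each of the heights 1, …, p i D exactly once.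
  unique-heights : ∀ i → Unique (heights i D)
  unique-heights i = ⊆-unique _≟_ (Unique.map⁺ suc-injective (Unique.upTo⁺ (p i D))) one-to-p
    (≤-reflexive (trans (length-heights i loopless-D) (sym (trans (length-map suc (upTo (p i D))) (length-upTo (p i D))))))
    where
    one-to-p : ∀ {h} → h ∈ map suc (upTo (p i D)) → h ∈ heights i D
    one-to-p h∈ with ∈-map⁻ suc h∈
    ... | h′ , h′∈ , refl = height-from-range (s≤s z≤n) (∈-upTo⁻ h′∈)

  slots-D : SlotInjective D
  slots-D = slots-from-unique-heights D unique-heights

  Permutes : (ℕ → ℕ → ℕ) → Set
  Permutes σ = ∀ i → IsPermOf (p i D) (σ i)

  permutes-injective : ∀ {σ} → Permutes σ → InjectiveOnHeights σ D
  permutes-injective perm {i} h∈ h′∈ =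
    proj₂ (perm i) _ _ (proj₁ (height-range h∈)) (proj₂ (height-range h∈)) (proj₁ (height-range h′∈)) (proj₂ (height-range h′∈))

  permuted-inWorld : ∀ {R σ} → R ↭ map (relabel σ) D → Permutes σ → InWorld D R
  permuted-inWorld {σ = σ} R↭ perm =
    unique-↭ (↭-sym R↭) (unique-relabel unique-D slots-D (permutes-injective perm)) ,
    σ , perm , All.tabulate (∈-resp-↭ R↭) , All.tabulate (∈-resp-↭ (↭-sym R↭))

  module Member {D₁ : Diagram} (w : InWorld D D₁) where

    σ₁ : ℕ → ℕ → ℕ
    σ₁ = proj₁ (proj₂ w)

    permutes₁ : Permutes σ₁
    permutes₁ = proj₁ (proj₂ (proj₂ w))

    unique-D₁ : Unique D₁
    unique-D₁ = proj₁ w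

    D₁↭ : D₁ ↭ map (relabel σ₁) D
    D₁↭ = unique-same-members⇒↭ unique-D₁ (unique-relabel unique-D slots-D (permutes-injective permutes₁))
            (All.lookup (proj₁ (proj₂ (proj₂ (proj₂ w))))) (All.lookup (proj₂ (proj₂ (proj₂ (proj₂ w)))))

    length-D₁ : length D₁ ≡ length D
    length-D₁ = trans (↭-length D₁↭) (length-map (relabel σ₁) D)

    p-D₁ : ∀ i → p i D₁ ≡ p i D
    p-D₁ i = trans (p-↭ i D₁↭) (p-relabel i σ₁ D)

    loopless-D₁ : Loopless D₁
    loopless-D₁ = loopless-↭ D₁↭ (Allₚ.map⁺ loopless-D)

    slots-D₁ : SlotInjective D₁
    slots-D₁ = slotInjective-↭ D₁↭ (slotInjective-relabel slots-D (permutes-injective permutes₁))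

    -- A diagram stacked from a rearrangement of D₁ lies in the web world:
    -- its relabelling, composed with σ₁, permutes the heights of D.
    stacked-inWorld : ∀ {X R σ} → X ↭ D₁ → Stacked X R σ → InWorld D R
    stacked-inWorld {X} {R} {σ} X↭D₁ stacked = permuted-inWorld R↭ permutes-τ
      where
      open Stacked stacked
      τ : ℕ → ℕ → ℕ
      τ i h = σ i (σ₁ i h)
      R↭ : R ↭ map (relabel τ) D
      R↭ = ↭-trans arrangement (↭-trans (map⁺ (relabel σ) (↭-trans X↭D₁ D₁↭)) (↭-reflexive (sym (map-∘ D))))
      moved : ∀ {i h} → 1 ≤ h → h ≤ p i D → σ₁ i h ∈ heights i X
      moved 1≤h h≤p = ∈heights-↭ (↭-sym (↭-trans X↭D₁ D₁↭)) (∈heights-relabel σ₁ D (height-from-range 1≤h h≤p))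
      permutes-τ : Permutes τ
      permutes-τ i =
        (λ h 1≤h h≤p → proj₁ (in-range (moved 1≤h h≤p)) ,
                       ≤-trans (proj₂ (in-range (moved 1≤h h≤p))) (≤-reflexive (trans (p-↭ i X↭D₁) (p-D₁ i)))) ,
        (λ h h′ 1≤h h≤p 1≤h′ h′≤p eq → proj₂ (permutes₁ i) h h′ 1≤h h≤p 1≤h′ h′≤p
                                         (injective (moved 1≤h h≤p) (moved 1≤h′ h′≤p) eq))

    reconstruct-inWorld : ∀ {ℓ} (c : Fin (length D₁) → Fin ℓ) → InWorld D (reconstruct D₁ c)
    reconstruct-inWorld {ℓ} c =
      stacked-inWorld classes↭ (proj₂ (stack-all (allFin ℓ) stacked-[] (unique-↭ (↭-sym classes↭) unique-D₁) (∈-resp-↭ classes↭)))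
      where
      open StackAll D₁ slots-D₁ loopless-D₁ (colourClass D₁ c)
      classes↭ : concatMap (colourClass D₁ c) (allFin ℓ) ↭ D₁
      classes↭ = colourClasses-↭ D₁ c unique-D₁

≈D-sym : ∀ {A B} → A ≈D B → B ≈D A
≈D-sym (A⊆B , B⊆A) = B⊆A , A⊆B

≈D-trans : ∀ {A B C} → A ≈D B → B ≈D C → A ≈D C
≈D-trans (A⊆B , B⊆A) (B⊆C , C⊆B) =
  All.tabulate (λ e∈A → All.lookup B⊆C (All.lookup A⊆B e∈A)) , All.tabulate (λ e∈C → All.lookup B⊆A (All.lookup C⊆B e∈C))

S₂-vanishes : ∀ m k → m < k → S₂ m k ≡ 0
S₂-vanishes zero    (suc k) _       = refl
S₂-vanishes (suc m) (suc k) (s≤s m<k)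
  rewrite S₂-vanishes m (suc k) (m≤n⇒m≤1+n m<k) | S₂-vanishes m k m<k = trans (+-identityʳ _) (*-zeroʳ k)

orderedBellCoef-suc : ∀ m k → suc k ! * S₂ m (suc k) ≡ orderedBellCoef m (suc k)
orderedBellCoef-suc m k with suc k ≤? m
... | yes _    = refl
... | no k+1≰m = trans (cong (suc k ! *_) (S₂-vanishes m (suc k) (≰⇒> k+1≰m))) (*-zeroʳ (suc k !))

-- Theorem 2.14: every row sum of the web-colouring matrix is the ordered Bell
-- polynomial of |D|, hence all row sums agree.
theorem2p14 : (n : ℕ) (D : Diagram) → IsWeb n D → 1 ≤ length D →
    (Ws : List Diagram) → EnumeratesWorld D Ws →
    ((D1 D1' : Diagram) → InWorld D D1 → InWorld D D1' →
       ∀ ℓ → rowSumCoef Ws D1 ℓ ≡ rowSumCoef Ws D1' ℓ)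
    × ((D1 : Diagram) → InWorld D D1 →
       ∀ ℓ → rowSumCoef Ws D1 ℓ ≡ orderedBellCoef (length D) ℓ)
theorem2p14 n D web _ Ws (_ , covers , distinct) =
  (λ D1 D1′ w w′ ℓ → trans (row-sum D1 w ℓ) (sym (row-sum D1′ w′ ℓ))) , row-sum
  where
  open WebWorld web
  row-sum : (D1 : Diagram) → InWorld D D1 → ∀ ℓ → rowSumCoef Ws D1 ℓ ≡ orderedBellCoef (length D) ℓ
  -- The constant coefficients vanish; for ℓ ≥ 1 each surjective colouring
  -- reconstructs exactly one listed diagram.
  row-sum D1 w zero    = sum-map-zero _ (All.universal (λ _ → refl) Ws)
  row-sum D1 w (suc k) = begin
    rowSumCoef Ws D1 (suc k)
      ≡⟨ count-fibres isSurj? (λ D2 c → reconstruct D1 c ≈D? D2) (allFuns (length D1) (suc k)) Ws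
           (λ c _ → exactly-one _≈D?_ ≈D-sym ≈D-trans (reconstruct D1 c) Ws (covers _ (reconstruct-inWorld c)) distinct) ⟩
    count isSurj? (allFuns (length D1) (suc k))
      ≡⟨ count-surjections (length D1) (suc k) ⟩
    suc k ! * S₂ (length D1) (suc k)
      ≡⟨ cong (λ m → suc k ! * S₂ m (suc k)) length-D₁ ⟩
    suc k ! * S₂ (length D) (suc k)
      ≡⟨ orderedBellCoef-suc (length D) k ⟩
    orderedBellCoef (length D) (suc k) ∎
    where open Member w
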